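{- Let $n \geq 2$ and let $T$ be a full binary plane tree with $n$ leaves (every internal node has exactly two children, a left and a right child). Then \[ K(\Psi(T)) + K(\Psi'(T)) = n, \qquad K(\Psi(T)) = U_V(\Psi'(T)), \qquad U_K(\Psi(T)) = V(\Psi'(T)). \]
   Context: For such a tree $T$ with $q$ nodes, $\Psi(T)$ is defined as follows: label the nodes $a_1, \dots, a_q$ in preorder (root, then left subtree, then right subtree, recursively), and set $\Psi(T) = \psi(a_2)\psi(a_3)\cdots\psi(a_q)$, where $\psi(a_i) = U$ if $a_i$ is the left child of its parent and $\psi(a_i) = D$ if $a_i$ is the right child of its parent. $\Psi'(T)$ is defined by labeling the nodes $a_1, \dots, a_q$ in the order root, then right subtree, then left subtree (recursively), and setting $\Psi'(T) = \psi'(a_2)\cdots\psi'(a_q)$, where $\psi'(a_i) = U$ if $a_i$ is the right child of its parent and $\psi'(a_i) = D$ if $a_i$ is the left child. Both are Dyck paths from $(0,0)$ to $(2n-2,0)$, viewing $U=(1,1)$ and $D=(1,-1)$ as lattice steps. For a Dyck path $P$: a peak is an occurrence of consecutive steps $UD$, a valley an occurrence of $DU$; $K(P)$ and $V(P)$ are the numbers of peaks and valleys; $U_K(P)$ (resp. $U_V(P)$) is the number of up steps of $P$ not contained in a peak (resp. not contained in a valley). -}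

module Defs where

open import Data.Nat using (ℕ; zero; suc; _+_)
open import Data.List using (List; []; _∷_; _++_)

data Tree : Set where
  leaf : Tree
  node : (l r : Tree) → Tree

leaves : Tree → ℕ
leaves leaf = 1
leaves (node l r) = leaves l + leaves r

data Step : Set where
  U D : Step

-- Ψ: preorder (root, left, right); each non-root node contributes
-- U if it is a left child and D if it is a right child.
Ψ : Tree → List Step
Ψ leaf = []
Ψ (node l r) = (U ∷ Ψ l) ++ (D ∷ Ψ r)

-- Ψ': order (root, right, left); U for a right child, D for a left child.
Ψ' : Tree → List Step
Ψ' leaf = []
Ψ' (node l r) = (U ∷ Ψ' r) ++ (D ∷ Ψ' l)

K : List Step → ℕ
K [] = 0
K (U ∷ D ∷ xs) = suc (K (D ∷ xs))
K (_ ∷ xs) = K xs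

V : List Step → ℕ
V [] = 0
V (D ∷ U ∷ xs) = suc (V (U ∷ xs))
V (_ ∷ xs) = V xs

-- U_K: number of up steps not contained in a peak
-- (an up step is in a peak iff it is immediately followed by D).
U-K : List Step → ℕ
U-K [] = 0
U-K (U ∷ D ∷ xs) = U-K (D ∷ xs)
U-K (U ∷ xs) = suc (U-K xs)
U-K (D ∷ xs) = U-K xs

-- U_V: number of up steps not contained in a valley
-- (an up step is in a valley iff it is immediately preceded by D).
U-V-aux : Step → List Step → ℕ   -- first argument: previous step
U-V-aux _ [] = 0
U-V-aux D (U ∷ xs) = U-V-aux U xs
U-V-aux _ (U ∷ xs) = suc (U-V-aux U xs)
U-V-aux _ (D ∷ xs) = U-V-aux D xs

U-V : List Step → ℕ
U-V [] = 0
U-V (U ∷ xs) = suc (U-V-aux U xs)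
U-V (D ∷ xs) = U-V-aux D xs

-- Ψ' T is Ψ of the mirror image of T, so everything reduces to statistics of Ψ.
-- In Ψ T a peak U D arises exactly when a left child is a leaf, so K (Ψ T)
-- counts the left leaves; similarly U_V (Ψ T) counts the right leaves. Every up
-- step lies either in a peak or not, and either in a valley or not, and there is
-- one up step per internal node; comparing the two splittings gives U_K = V.
module Submission where

open import Defs
open import Data.Nat using (ℕ; _+_; _≤_; suc; s≤s)
open import Data.Nat.Properties
  using (+-suc; +-comm; +-assoc; +-cancelʳ-≡; +-commutativeSemigroup)
open import Data.Nat.Tactic.RingSolver using (solve-∀)
open import Algebra.Properties.CommutativeSemigroup +-commutativeSemigroup
  using (interchange)
open import Data.List using (List; []; _∷_; _++_)
open import Data.Product using (_×_; _,_)
open import Relation.Binary.PropositionalEquality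
open ≡-Reasoning

-- p acts as a virtual step in front of the list.
pairCount : (Step → Step → ℕ) → Step → List Step → ℕ
pairCount w p [] = 0
pairCount w p (x ∷ xs) = w p x + pairCount w x xs

lastStep : Step → List Step → Step
lastStep p [] = p
lastStep p (x ∷ xs) = lastStep x xs

pairCount-++ : ∀ w p xs ys →
  pairCount w p (xs ++ ys) ≡ pairCount w p xs + pairCount w (lastStep p xs) ys
pairCount-++ w p [] ys = refl
pairCount-++ w p (x ∷ xs) ys =
  trans (cong (w p x +_) (pairCount-++ w x xs ys)) (sym (+-assoc (w p x) _ _))

lastStep-++ : ∀ p xs ys → lastStep p (xs ++ ys) ≡ lastStep (lastStep p xs) ys
lastStep-++ p [] ys = refl
lastStep-++ p (x ∷ xs) ys = lastStep-++ x xs ys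

pairCount-+ : ∀ {v w u : Step → Step → ℕ} → (∀ p x → v p x + w p x ≡ u p x) →
  ∀ p xs → pairCount v p xs + pairCount w p xs ≡ pairCount u p xs
pairCount-+ vw≡u p [] = refl
pairCount-+ {v} {w} vw≡u p (x ∷ xs) =
  trans (interchange (v p x) _ (w p x) _)
        (cong₂ _+_ (vw≡u p x) (pairCount-+ vw≡u x xs))

peak valley ascent up : Step → Step → ℕ
peak _ U = 0
peak U D = 1
peak D D = 0
valley _ D = 0
valley D U = 1
valley U U = 0
ascent _ D = 0
ascent U U = 1
ascent D U = 0
up _ U = 1
up _ D = 0

valley+ascent≡up : ∀ p x → valley p x + ascent p x ≡ up p x
valley+ascent≡up U U = refl
valley+ascent≡up D U = refl
valley+ascent≡up _ D = refl

K≡peaks : ∀ xs → K xs ≡ pairCount peak D xs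
K≡peaks [] = refl
K≡peaks (U ∷ []) = refl
K≡peaks (U ∷ D ∷ xs) = cong suc (K≡peaks (D ∷ xs))
K≡peaks (U ∷ U ∷ xs) = K≡peaks (U ∷ xs)
K≡peaks (D ∷ xs) = K≡peaks xs

V≡valleys : ∀ xs → V xs ≡ pairCount valley U xs
V≡valleys [] = refl
V≡valleys (D ∷ []) = refl
V≡valleys (D ∷ U ∷ xs) = cong suc (V≡valleys (U ∷ xs))
V≡valleys (D ∷ D ∷ xs) = V≡valleys (D ∷ xs)
V≡valleys (U ∷ xs) = V≡valleys xs

U-V-aux≡ascents : ∀ p xs → U-V-aux p xs ≡ pairCount ascent p xs
U-V-aux≡ascents p [] = refl
U-V-aux≡ascents D (U ∷ xs) = U-V-aux≡ascents U xs
U-V-aux≡ascents U (U ∷ xs) = cong suc (U-V-aux≡ascents U xs)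
U-V-aux≡ascents U (D ∷ xs) = U-V-aux≡ascents D xs
U-V-aux≡ascents D (D ∷ xs) = U-V-aux≡ascents D xs

U-V≡ascents : ∀ xs → U-V xs ≡ pairCount ascent U xs
U-V≡ascents [] = refl
U-V≡ascents (U ∷ xs) = cong suc (U-V-aux≡ascents U xs)
U-V≡ascents (D ∷ xs) = U-V-aux≡ascents D xs

U-K+K≡ups : ∀ p xs → U-K xs + K xs ≡ pairCount up p xs
U-K+K≡ups p [] = refl
U-K+K≡ups p (U ∷ []) = refl
U-K+K≡ups p (U ∷ D ∷ xs) =
  trans (+-suc (U-K (D ∷ xs)) (K (D ∷ xs))) (cong suc (U-K+K≡ups U (D ∷ xs)))
U-K+K≡ups p (U ∷ U ∷ xs) = cong suc (U-K+K≡ups U (U ∷ xs))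
U-K+K≡ups p (D ∷ xs) = U-K+K≡ups D xs

V+U-V≡ups : ∀ xs → V xs + U-V xs ≡ pairCount up U xs
V+U-V≡ups xs = begin
  V xs + U-V xs
    ≡⟨ cong₂ _+_ (V≡valleys xs) (U-V≡ascents xs) ⟩
  pairCount valley U xs + pairCount ascent U xs
    ≡⟨ pairCount-+ valley+ascent≡up U xs ⟩
  pairCount up U xs ∎

mirror : Tree → Tree
mirror leaf = leaf
mirror (node l r) = node (mirror r) (mirror l)

Ψ'≡Ψ∘mirror : ∀ T → Ψ' T ≡ Ψ (mirror T)
Ψ'≡Ψ∘mirror leaf = refl
Ψ'≡Ψ∘mirror (node l r) rewrite Ψ'≡Ψ∘mirror l | Ψ'≡Ψ∘mirror r = refl

isLeaf : Tree → ℕ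
isLeaf leaf = 1
isLeaf (node _ _) = 0

leftLeaves rightLeaves internalNodes : Tree → ℕ
leftLeaves leaf = 0
leftLeaves (node l r) = leftLeaves l + (isLeaf l + leftLeaves r)
rightLeaves leaf = 0
rightLeaves (node l r) = rightLeaves r + (isLeaf r + rightLeaves l)
internalNodes leaf = 0
internalNodes (node l r) = suc (internalNodes l + internalNodes r)

isLeaf-mirror : ∀ T → isLeaf (mirror T) ≡ isLeaf T
isLeaf-mirror leaf = refl
isLeaf-mirror (node _ _) = refl

leftLeaves-mirror : ∀ T → leftLeaves (mirror T) ≡ rightLeaves T
rightLeaves-mirror : ∀ T → rightLeaves (mirror T) ≡ leftLeaves T
leftLeaves-mirror leaf = refl
leftLeaves-mirror (node l r)
  rewrite leftLeaves-mirror r | isLeaf-mirror r | leftLeaves-mirror l = refl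
rightLeaves-mirror leaf = refl
rightLeaves-mirror (node l r)
  rewrite rightLeaves-mirror r | isLeaf-mirror l | rightLeaves-mirror l = refl

internalNodes-mirror : ∀ T → internalNodes (mirror T) ≡ internalNodes T
internalNodes-mirror leaf = refl
internalNodes-mirror (node l r)
  rewrite internalNodes-mirror l | internalNodes-mirror r =
  cong suc (+-comm (internalNodes r) _)

leftLeaves+rightLeaves : ∀ T → isLeaf T + leftLeaves T + rightLeaves T ≡ leaves T
leftLeaves+rightLeaves leaf = refl
leftLeaves+rightLeaves (node l r) = begin
  leftLeaves l + (isLeaf l + leftLeaves r) + (rightLeaves r + (isLeaf r + rightLeaves l))
    ≡⟨ regroup (leftLeaves l) (isLeaf l) (leftLeaves r) (rightLeaves r) (isLeaf r) _ ⟩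
  (isLeaf l + leftLeaves l + rightLeaves l) + (isLeaf r + leftLeaves r + rightLeaves r)
    ≡⟨ cong₂ _+_ (leftLeaves+rightLeaves l) (leftLeaves+rightLeaves r) ⟩
  leaves l + leaves r ∎
  where
  regroup : ∀ a b c d e f → a + (b + c) + (d + (e + f)) ≡ (b + a + f) + (e + c + d)
  regroup = solve-∀

pairCount-Ψ : ∀ w p l r → pairCount w p (Ψ (node l r)) ≡
  w p U + pairCount w U (Ψ l) + (w (lastStep U (Ψ l)) D + pairCount w D (Ψ r))
pairCount-Ψ w p l r = pairCount-++ w p (U ∷ Ψ l) (D ∷ Ψ r)

lastStep-Ψ-node : ∀ p l r → lastStep p (Ψ (node l r)) ≡ D
lastStep-Ψ-node p l r = trans (lastStep-++ p (U ∷ Ψ l) (D ∷ Ψ r)) (lastStep-Ψ r)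
  where
  lastStep-Ψ : ∀ T → lastStep D (Ψ T) ≡ D
  lastStep-Ψ leaf = refl
  lastStep-Ψ (node l r) = lastStep-Ψ-node D l r

peak-after-Ψ : ∀ T → peak (lastStep U (Ψ T)) D ≡ isLeaf T
peak-after-Ψ leaf = refl
peak-after-Ψ (node l r) = cong (λ s → peak s D) (lastStep-Ψ-node U l r)

peaks-Ψ : ∀ p T → pairCount peak p (Ψ T) ≡ leftLeaves T
peaks-Ψ p leaf = refl
peaks-Ψ p (node l r)
  rewrite pairCount-Ψ peak p l r | peaks-Ψ U l | peaks-Ψ D r | peak-after-Ψ l = refl

ascents-Ψ : ∀ T → pairCount ascent U (Ψ T) ≡ rightLeaves T
ascents-from-D-Ψ : ∀ T → suc (pairCount ascent D (Ψ T)) ≡ isLeaf T + rightLeaves T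
ascents-Ψ leaf = refl
ascents-Ψ (node l r) rewrite pairCount-Ψ ascent U l r | ascents-Ψ l =
  begin
  suc (rightLeaves l + pairCount ascent D (Ψ r))  ≡⟨ sym (+-suc (rightLeaves l) _) ⟩
  rightLeaves l + suc (pairCount ascent D (Ψ r))  ≡⟨ cong (rightLeaves l +_) (ascents-from-D-Ψ r) ⟩
  rightLeaves l + (isLeaf r + rightLeaves r)      ≡⟨ shuffle (rightLeaves l) (isLeaf r) _ ⟩
  rightLeaves r + (isLeaf r + rightLeaves l)      ∎
  where
  shuffle : ∀ a b c → a + (b + c) ≡ c + (b + a)
  shuffle = solve-∀
-- The first step of Ψ (node l r) is U, and ascent D U = 0 while ascent U U = 1.
ascents-from-D-Ψ leaf = refl
ascents-from-D-Ψ (node l r) = ascents-Ψ (node l r)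

ups-Ψ : ∀ p T → pairCount up p (Ψ T) ≡ internalNodes T
ups-Ψ p leaf = refl
ups-Ψ p (node l r) rewrite pairCount-Ψ up p l r | ups-Ψ U l | ups-Ψ D r = refl

K-Ψ : ∀ T → K (Ψ T) ≡ leftLeaves T
K-Ψ T = trans (K≡peaks (Ψ T)) (peaks-Ψ D T)

U-V-Ψ : ∀ T → U-V (Ψ T) ≡ rightLeaves T
U-V-Ψ T = trans (U-V≡ascents (Ψ T)) (ascents-Ψ T)

U-K+K-Ψ : ∀ T → U-K (Ψ T) + K (Ψ T) ≡ internalNodes T
U-K+K-Ψ T = trans (U-K+K≡ups U (Ψ T)) (ups-Ψ U T)

V+U-V-Ψ : ∀ T → V (Ψ T) + U-V (Ψ T) ≡ internalNodes T
V+U-V-Ψ T = trans (V+U-V≡ups (Ψ T)) (ups-Ψ U T)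

K-Ψ' : ∀ T → K (Ψ' T) ≡ rightLeaves T
K-Ψ' T = trans (cong K (Ψ'≡Ψ∘mirror T)) (trans (K-Ψ (mirror T)) (leftLeaves-mirror T))

U-V-Ψ' : ∀ T → U-V (Ψ' T) ≡ leftLeaves T
U-V-Ψ' T =
  trans (cong U-V (Ψ'≡Ψ∘mirror T)) (trans (U-V-Ψ (mirror T)) (rightLeaves-mirror T))

V+U-V-Ψ' : ∀ T → V (Ψ' T) + U-V (Ψ' T) ≡ internalNodes T
V+U-V-Ψ' T = trans (cong (λ xs → V xs + U-V xs) (Ψ'≡Ψ∘mirror T))
                   (trans (V+U-V-Ψ (mirror T)) (internalNodes-mirror T))

lemma14 : (n : ℕ) → 2 ≤ n → (T : Tree) → leaves T ≡ n →
    (K (Ψ T) + K (Ψ' T) ≡ n) × (K (Ψ T) ≡ U-V (Ψ' T)) × (U-K (Ψ T) ≡ V (Ψ' T))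
lemma14 _ _ T@(node _ _) refl =
  trans (cong₂ _+_ (K-Ψ T) (K-Ψ' T)) (leftLeaves+rightLeaves T) ,
  K≡U-V ,
  +-cancelʳ-≡ _ _ _ (begin
    U-K (Ψ T) + K (Ψ T)      ≡⟨ U-K+K-Ψ T ⟩
    internalNodes T          ≡⟨ sym (V+U-V-Ψ' T) ⟩
    V (Ψ' T) + U-V (Ψ' T)    ≡⟨ cong (V (Ψ' T) +_) (sym K≡U-V) ⟩
    V (Ψ' T) + K (Ψ T)       ∎)
  where
  K≡U-V : K (Ψ T) ≡ U-V (Ψ' T)
  K≡U-V = trans (K-Ψ T) (sym (U-V-Ψ' T))
lemma14 _ (s≤s ()) leaf refl
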